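{- The linear map $F_\sigma\mapsto F_{\prec_\sigma}$ is a Hopf algebra isomorphism from the Malvenuto--Reutenauer Hopf algebra on permutations to the quotient Hopf algebra $(\mathbb{K}\mathrm{WOEP}^{\mathrm{quo}},\cdot,\Delta)$.
   Context: For $n \ge 0$ let $[n]=\{1,\dots,n\}$. An integer poset of size $n$ is a reflexive, antisymmetric, transitive relation on $[n]$. For $R$ of size $n$ and $X=\{x_1<\dots<x_k\}\subseteq[n]$, $R_X=\{(i,j)\in[k]^2:(x_i,x_j)\in R\}$. For $S$ of size $n$, $m\ge0$: $\overline{S}=\{(m+i,m+j):(i,j)\in S\}$, $\overline{[n]}=\{m+1,\dots,m+n\}$. For $R$ of size $m$: $\mathrm{Sh}(R,S)$ is the set of all $R\cup\overline{S}\cup I\cup D$ with $I\subseteq[m]\times\overline{[n]}$, $D\subseteq\overline{[n]}\times[m]$. A total cut of $T$ on $[p]$ is a partition $[p]=X\sqcup Y$ with $(x,y)\in T$, $(y,x)\notin T$ for all $x\in X,y\in Y$; $R\star S$ is the set of relations $T$ on $[m+n]$ admitting a total cut $(X,Y)$ with $T_X=R$, $T_Y=S$. $\mathbb{K}\mathrm{WOEP}^{\mathrm{quo}}$ is the vector space with basis $(F_\prec)$ indexed by total orders $\prec$ on $[n]$, $n\ge0$, with product $F_\prec\cdot F_\lhd=\sum_{T\in\mathrm{Sh}(\prec,\lhd),\ T\text{ total order}}F_T$ and coproduct $\Delta(F_T)=\sum_{(R,S):T\in R\star S}F_R\otimes F_S$ (all such $R,S$ are total orders). For a permutation $\sigma$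 of $[n]$, $\prec_\sigma$ is the total order $\sigma(1)\prec_\sigma\sigma(2)\prec_\sigma\dots\prec_\sigma\sigma(n)$. The Malvenuto--Reutenauer Hopf algebra has basis $(F_\sigma)$ indexed by permutations of $[n]$, $n\ge0$ (written as words $\sigma(1)\dots\sigma(n)$), product $F_\sigma\cdot F_\tau=\sum_{\rho}F_\rho$ over $\rho\in\mathfrak{S}_{m+n}$ whose subword of values in $[m]$ is $\sigma$ and whose subword of values in $\{m+1,\dots,m+n\}$ is $\tau$ shifted by $m$ (for $\sigma\in\mathfrak S_m,\tau\in\mathfrak S_n$), and coproduct $\Delta(F_\rho)=\sum F_\sigma\otimes F_\tau$ over pairs $(\sigma,\tau)\in\mathfrak S_m\times\mathfrak S_n$, $m+n$ the size of $\rho$, such that the first $m$ letters of $\rho$ standardize to $\sigma$ and the last $n$ letters standardize to $\tau$. -}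

module Defs where

open import Data.Bool using (Bool; true; false; _∨_)
open import Data.Nat using (ℕ; _+_)
open import Data.Fin using (Fin; splitAt; toℕ; _↑ˡ_; _↑ʳ_; _<_; _≤?_; _<?_)
open import Data.Fin.Permutation using (Permutation′; _⟨$⟩ʳ_; _⟨$⟩ˡ_)
open import Data.List using (List; map; mapMaybe; filter; length; allFin)
open import Data.Maybe using (Maybe; just; nothing)
open import Data.Sum using (_⊎_; inj₁; inj₂)
open import Data.Product using (Σ; _×_; ∃; ∃-syntax)
open import Relation.Binary.PropositionalEquality using (_≡_; _≢_)
open import Relation.Nullary.Decidable using (⌊_⌋)

-- Relations on [n] = Fin n (0-indexed), as Boolean-valued predicates:
-- (i , j) ∈ R  iff  R i j ≡ true.

BRel : ℕ → Set
BRel n = Fin n → Fin n → Bool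

_≐_ : ∀ {n} → BRel n → BRel n → Set
R ≐ S = ∀ i j → R i j ≡ S i j

record IsTotalOrder {n : ℕ} (R : BRel n) : Set where
  field
    refl′  : ∀ i → R i i ≡ true
    antisym : ∀ i j → R i j ≡ true → R j i ≡ true → i ≡ j
    trans′ : ∀ i j k → R i j ≡ true → R j k ≡ true → R i k ≡ true
    total  : ∀ i j → R i j ≡ true ⊎ R j i ≡ true

-- Permutations and the total order ≺_σ :  σ(1) ≺ σ(2) ≺ … ≺ σ(n),
-- i.e.  a ≺_σ b  iff  σ⁻¹(a) ≤ σ⁻¹(b).

Perm : ℕ → Set
Perm = Permutation′

ord : ∀ {n} → Perm n → BRel n
ord σ a b = ⌊ (σ ⟨$⟩ˡ a) ≤? (σ ⟨$⟩ˡ b) ⌋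

_≈ₚ_ : ∀ {n} → Perm n → Perm n → Set
σ ≈ₚ τ = ∀ i → σ ⟨$⟩ʳ i ≡ τ ⟨$⟩ʳ i

-- Shuffle set Sh(R,S): T = R ∪ S̄ ∪ I ∪ D  with I ⊆ [m]×[n]‾, D ⊆ [n]‾×[m].

embR : ∀ {m n} → BRel m → BRel (m + n)
embR {m} R p q with splitAt m p | splitAt m q
... | inj₁ i | inj₁ j = R i j
... | _      | _      = false

embS : ∀ {m n} → BRel n → BRel (m + n)
embS {m} S p q with splitAt m p | splitAt m q
... | inj₂ i | inj₂ j = S i j
... | _      | _      = false

embI : ∀ {m n} → (Fin m → Fin n → Bool) → BRel (m + n)
embI {m} I p q with splitAt m p | splitAt m q
... | inj₁ i | inj₂ j = I i j
... | _      | _      = false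

embD : ∀ {m n} → (Fin n → Fin m → Bool) → BRel (m + n)
embD {m} D p q with splitAt m p | splitAt m q
... | inj₂ j | inj₁ i = D j i
... | _      | _      = false

InSh : ∀ {m n} → BRel (m + n) → BRel m → BRel n → Set
InSh {m} {n} T R S =
  Σ (Fin m → Fin n → Bool) λ I → Σ (Fin n → Fin m → Bool) λ D →
    ∀ p q → T p q ≡ (embR {m} {n} R p q ∨ embS {m} {n} S p q
                       ∨ embI {m} {n} I p q ∨ embD {m} {n} D p q)

-- R ⋆ S : T admits a total cut (X , Y) with T_X = R, T_Y = S.
-- A subset X = {x₁ < … < x_k} of [p] is given by its increasing
-- enumeration x : Fin k → Fin p; T_X (i , j) = T (x i) (x j).

StrictlyIncreasing : ∀ {k p} → (Fin k → Fin p) → Set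
StrictlyIncreasing x = ∀ i j → i < j → x i < x j

InStar : ∀ {m n} → BRel (m + n) → BRel m → BRel n → Set
InStar {m} {n} T R S =
  Σ (Fin m → Fin (m + n)) λ x → Σ (Fin n → Fin (m + n)) λ y →
    StrictlyIncreasing x × StrictlyIncreasing y
    × (∀ i j → x i ≢ y j)
    × (∀ q → (∃[ i ] x i ≡ q) ⊎ (∃[ j ] y j ≡ q))
    × (∀ i j → T (x i) (y j) ≡ true × T (y j) (x i) ≡ false)
    × (∀ i i′ → T (x i) (x i′) ≡ R i i′)
    × (∀ j j′ → T (y j) (y j′) ≡ S j j′)

word : ∀ {n} → Perm n → List (Fin n)
word {n} σ = map (σ ⟨$⟩ʳ_) (allFin n)

leftVal : ∀ {m n} → Fin (m + n) → Maybe (Fin m)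
leftVal {m} v with splitAt m v
... | inj₁ i = just i
... | inj₂ _ = nothing

rightVal : ∀ {m n} → Fin (m + n) → Maybe (Fin n)
rightVal {m} v with splitAt m v
... | inj₁ _ = nothing
... | inj₂ j = just j

-- ρ occurs in F_σ · F_τ : the subword of values in [m] is σ and the
-- subword of values in {m+1..m+n} is τ shifted by m
MRProd : ∀ {m n} → Perm m → Perm n → Perm (m + n) → Set
MRProd {m} {n} σ τ ρ =
  mapMaybe (leftVal {m} {n}) (word ρ) ≡ word σ
  × mapMaybe (rightVal {m} {n}) (word ρ) ≡ word τ

std : ∀ {k p} → (Fin k → Fin p) → Fin k → ℕ
std {k} w i = length (filter (λ j → w j <? w i) (allFin k))

-- F_σ ⊗ F_τ occurs in Δ(F_ρ)
MRCoprod : ∀ {m n} → Perm (m + n) → Perm m → Perm n → Set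
MRCoprod {m} {n} ρ σ τ =
  (∀ i → toℕ (σ ⟨$⟩ʳ i) ≡ std (λ k → ρ ⟨$⟩ʳ (k ↑ˡ n)) i)
  × (∀ j → toℕ (τ ⟨$⟩ʳ j) ≡ std (λ k → ρ ⟨$⟩ʳ (m ↑ʳ k)) j)

-- Everything rests on ranks. The value π i of a permutation is the number of j with π j < π i, so
-- a permutation is determined by the total order it induces; conversely, the rank of an element of
-- a total order (the number of elements strictly below it) is an injection of [n] into itself,
-- hence a permutation.
-- For the product, membership in Sh(≺σ, ≺τ) only constrains the two diagonal blocks of ≺ρ, and
-- the subword of ρ on the values in [m] is σ iff ≺ρ restricts to ≺σ there, because a list without
-- repetitions is determined by which of its elements occur no later than which.
-- For the coproduct, the first m letters of ρ standardise to σ iff listing them in σ-order is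
-- increasing, which yields a total cut; conversely, in a total cut the position of each element is
-- the number of elements before it, and the cut determines that number.

module Submission where

open import Defs
open import Data.Nat as ℕ using (ℕ; zero; suc; _+_)
open import Data.Product as Product using (_×_; ∃-syntax; _,_; proj₁; proj₂)
open import Function.Bundles using (_⇔_; mk⇔; Injection)

open import Level using (Level)
import Algebra.Properties.CommutativeMonoid.Sum as Summation
open import Data.Bool using (Bool; true; false; if_then_else_; _∨_)
import Data.Bool.Properties as Boolₚ
open import Data.Fin as Fin
  using (Fin; zero; suc; toℕ; fromℕ<; splitAt; _↑ˡ_; _↑ʳ_; _≤_; _<_; _≤?_; _<?_)
import Data.Fin.Properties as Finₚ
open import Data.Fin.Permutation
  using (Permutation′; permutation; flip; _⟨$⟩ʳ_; _⟨$⟩ˡ_; inverseʳ; inverseˡ)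
open import Data.List using (List; []; _∷_; tabulate; mapMaybe; filter; length)
import Data.List.Properties as LP
open import Data.List.Membership.Propositional using (_∈_)
open import Data.List.Membership.Propositional.Properties using (∈-tabulate⁺; ∈-tabulate⁻)
open import Data.List.Relation.Unary.Any using (here; there)
import Data.List.Relation.Unary.All as All
open import Data.List.Relation.Unary.AllPairs using ([]; _∷_)
open import Data.List.Relation.Unary.Unique.Propositional using (Unique)
import Data.List.Relation.Unary.Unique.Propositional.Properties as Uniqueₚ
open import Data.Maybe using (Maybe; just; nothing)
import Data.Nat.Properties as ℕₚ
open import Data.Product.Function.NonDependent.Propositional using (_×-⇔_)
open import Data.Sum as Sum using (_⊎_; inj₁; inj₂)
open import Data.Unit using (tt)
open import Function.Base using (id; _∘_; _on_; const) renaming (flip to flip′)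
open Function.Bundles.Equivalence using (to; from)
open import Function.Definitions using (Injective)
import Function.Properties.Equivalence as ⇔
open import Function.Properties.Inverse using (↔⇒↣)
open import Relation.Binary.Definitions using (tri<; tri≈; tri>)
open import Relation.Binary.PropositionalEquality
  using (_≡_; _≢_; refl; sym; trans; cong; cong₂; subst; subst₂; module ≡-Reasoning)
open import Relation.Nullary using (Dec; yes; no; does; ¬_; ¬?; _×-dec_; contradiction)
open import Relation.Nullary.Decidable using (⌊_⌋; dec-true; does-⇔)
open import Relation.Unary using (Pred; Decidable; _⊆_)
open import Relation.Unary.Properties using (U?)

private
  variable
    a b ℓ : Level
    A : Set a
    B : Set b
    k m n p : ℕ

⌊⌋≡true⇔ : (a? : Dec A) → ⌊ a? ⌋ ≡ true ⇔ A
⌊⌋≡true⇔ (yes a) = mk⇔ (const a) (const refl)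
⌊⌋≡true⇔ (no ¬a) = mk⇔ (λ ()) (flip′ contradiction ¬a)

⌊⌋≡false⇔ : (a? : Dec A) → ⌊ a? ⌋ ≡ false ⇔ (¬ A)
⌊⌋≡false⇔ (yes a) = mk⇔ (λ ()) (λ ¬a → contradiction a ¬a)
⌊⌋≡false⇔ (no ¬a) = mk⇔ (const ¬a) (const refl)

⌊⌋≡⌊⌋⇔ : (a? : Dec A) (b? : Dec B) → ⌊ a? ⌋ ≡ ⌊ b? ⌋ ⇔ (A ⇔ B)
⌊⌋≡⌊⌋⇔ (yes a) (yes b) = mk⇔ (const (mk⇔ (const b) (const a))) (const refl)
⌊⌋≡⌊⌋⇔ (yes a) (no ¬b) = mk⇔ (λ ()) (λ A⇔B → contradiction (to A⇔B a) ¬b)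
⌊⌋≡⌊⌋⇔ (no ¬a) (yes b) = mk⇔ (λ ()) (λ A⇔B → contradiction (from A⇔B b) ¬a)
⌊⌋≡⌊⌋⇔ (no ¬a) (no ¬b) =
  mk⇔ (const (mk⇔ (flip′ contradiction ¬a) (flip′ contradiction ¬b))) (const refl)

-- Counting

open Summation ℕₚ.+-0-commutativeMonoid using (sum; sum-cong-≗; sum-permute)

indicator : Bool → ℕ
indicator b = if b then 1 else 0

indicator-mono : (A → B) → (a? : Dec A) (b? : Dec B) → indicator (does a?) ℕ.≤ indicator (does b?)
indicator-mono f (no _)  _       = ℕ.z≤n
indicator-mono f (yes _) (yes _) = ℕₚ.≤-refl
indicator-mono f (yes x) (no ¬y) = contradiction (f x) ¬y

-- Opaque, so that unification can recover the predicate P? from count P?.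
opaque
  count : {P : Pred (Fin n) ℓ} → Decidable P → ℕ
  count {zero}  P? = 0
  count {suc n} P? = indicator (does (P? zero)) + count (P? ∘ suc)

  count≡sum : {P : Pred (Fin n) ℓ} (P? : Decidable P) → count P? ≡ sum (indicator ∘ does ∘ P?)
  count≡sum {zero}  P? = refl
  count≡sum {suc n} P? = cong (indicator (does (P? zero)) +_) (count≡sum (P? ∘ suc))

  count-cong : {P Q : Pred (Fin n) ℓ} {P? : Decidable P} {Q? : Decidable Q} →
               (∀ i → P i ⇔ Q i) → count P? ≡ count Q?
  count-cong {P? = P?} {Q?} P⇔Q = begin
    count P?                    ≡⟨ count≡sum P? ⟩
    sum (indicator ∘ does ∘ P?) ≡⟨ sum-cong-≗ (cong indicator ∘ does≡) ⟩
    sum (indicator ∘ does ∘ Q?) ≡⟨ count≡sum Q? ⟨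
    count Q?                    ∎
    where
    open ≡-Reasoning
    does≡ : ∀ i → does (P? i) ≡ does (Q? i)
    does≡ i = does-⇔ (P⇔Q i) (P? i) (Q? i)

  count-∘-cong : {P : Pred A ℓ} (P? : Decidable P) {f g : Fin n → A} →
                 (∀ i → f i ≡ g i) → count (P? ∘ f) ≡ count (P? ∘ g)
  count-∘-cong {P = P} P? f≗g = count-cong (λ i → mk⇔ (subst P (f≗g i)) (subst P (sym (f≗g i))))

  length-filter-tabulate : {P : Pred A ℓ} (P? : Decidable P) (f : Fin n → A) →
                           length (filter P? (tabulate f)) ≡ count (P? ∘ f)
  length-filter-tabulate {n = zero}  P? f = refl
  length-filter-tabulate {n = suc n} P? f with P? (f zero)
  ... | yes _ = cong suc (length-filter-tabulate P? (f ∘ suc))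
  ... | no _  = length-filter-tabulate P? (f ∘ suc)

  count-mono : {P Q : Pred (Fin n) ℓ} {P? : Decidable P} {Q? : Decidable Q} →
               P ⊆ Q → count P? ℕ.≤ count Q?
  count-mono {zero}                  P⊆Q = ℕ.z≤n
  count-mono {suc n} {P? = P?} {Q?} P⊆Q =
    ℕₚ.+-mono-≤ (indicator-mono P⊆Q (P? zero) (Q? zero))
                (count-mono {n = n} P⊆Q)

  count-mono-< : {P Q : Pred (Fin n) ℓ} {P? : Decidable P} {Q? : Decidable Q} →
                 P ⊆ Q → (i : Fin n) → ¬ P i → Q i → count P? ℕ.< count Q?
  count-mono-< {suc n} {P? = P?} {Q?} P⊆Q zero ¬Pi Qi with P? zero | Q? zero
  ... | yes Pi | _      = contradiction Pi ¬Pi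
  ... | no _   | no ¬Qi = contradiction Qi ¬Qi
  ... | no _   | yes _  = ℕ.s≤s (count-mono {n = n} P⊆Q)
  count-mono-< {suc n} {P? = P?} {Q?} P⊆Q (suc i) ¬Pi Qi =
    ℕₚ.+-mono-≤-< (indicator-mono P⊆Q (P? zero) (Q? zero)) (count-mono-< {n = n} P⊆Q i ¬Pi Qi)

  count-all : {P : Pred (Fin n) ℓ} (P? : Decidable P) → (∀ i → P i) → count P? ≡ n
  count-all {zero}  P? all = refl
  count-all {suc n} P? all with P? zero
  ... | yes _  = cong suc (count-all (P? ∘ suc) (all ∘ suc))
  ... | no ¬P0 = contradiction (all zero) ¬P0

  count-none : {P : Pred (Fin n) ℓ} (P? : Decidable P) → (∀ i → ¬ P i) → count P? ≡ 0
  count-none {zero}  P? none = refl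
  count-none {suc n} P? none with P? zero
  ... | yes P0 = contradiction P0 (none zero)
  ... | no _   = count-none (P? ∘ suc) (none ∘ suc)

  count-↑ˡ-↑ʳ : ∀ m {P : Pred (Fin (m + n)) ℓ} (P? : Decidable P) →
                count P? ≡ count (P? ∘ (_↑ˡ n)) + count (P? ∘ (m ↑ʳ_))
  count-↑ˡ-↑ʳ zero    P? = refl
  count-↑ˡ-↑ʳ (suc m) P? =
    trans (cong (indicator (does (P? zero)) +_) (count-↑ˡ-↑ʳ m (P? ∘ suc)))
          (sym (ℕₚ.+-assoc (indicator (does (P? zero))) _ _))

  count-permute : {P : Pred (Fin n) ℓ} (P? : Decidable P) (π : Permutation′ n) →
                  count (P? ∘ (π ⟨$⟩ʳ_)) ≡ count P?
  count-permute P? π = begin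
    count (P? ∘ (π ⟨$⟩ʳ_))                 ≡⟨ count≡sum (P? ∘ (π ⟨$⟩ʳ_)) ⟩
    sum (indicator ∘ does ∘ P? ∘ (π ⟨$⟩ʳ_)) ≡⟨ sum-permute (indicator ∘ does ∘ P?) π ⟨
    sum (indicator ∘ does ∘ P?)            ≡⟨ count≡sum P? ⟨
    count P?                              ∎
    where open ≡-Reasoning

  count-< : (c : Fin n) → count (λ (j : Fin n) → j <? c) ≡ toℕ c
  count-< {suc n} zero    = count-none (λ (j : Fin (suc n)) → j <? zero {n}) (λ _ ())
  count-< {suc n} (suc c) = begin
    indicator (does (zero {n} <? suc c)) + count (λ (j : Fin n) → suc j <? suc c)
      ≡⟨ cong₂ _+_ (cong indicator (dec-true (zero {n} <? suc c) ℕ.z<s))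
                   (count-cong {n = n} (λ _ → mk⇔ ℕ.s<s⁻¹ ℕ.s<s)) ⟩
    1 + count (λ (j : Fin n) → j <? c)
      ≡⟨ cong suc (count-< c) ⟩
    suc (toℕ c) ∎
    where open ≡-Reasoning

  toℕ-⟨$⟩ʳ≡count< : (π : Permutation′ n) (i : Fin n) →
                    toℕ (π ⟨$⟩ʳ i) ≡ count (λ j → π ⟨$⟩ʳ j <? π ⟨$⟩ʳ i)
  toℕ-⟨$⟩ʳ≡count< π i = sym (trans (count-permute (λ j → j <? π ⟨$⟩ʳ i) π) (count-< (π ⟨$⟩ʳ i)))

-- Orders induced by maps into Fin

-- ⌊_⌋ rather than does, so that ord σ is definitionally _≤ᵇ_ on (σ ⟨$⟩ˡ_).
_≤ᵇ_ : BRel n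
i ≤ᵇ j = ⌊ i ≤? j ⌋

≤ᵇ-on-isTotalOrder : {f : Fin n → Fin k} → Injective _≡_ _≡_ f → IsTotalOrder (_≤ᵇ_ on f)
≤ᵇ-on-isTotalOrder {f = f} f-inj = record
  { refl′   = λ i → from (⌊⌋≡true⇔ (f i ≤? f i)) ℕₚ.≤-refl
  ; antisym = λ i j i≤j j≤i →
      f-inj (Finₚ.≤-antisym (to (⌊⌋≡true⇔ (f i ≤? f j)) i≤j) (to (⌊⌋≡true⇔ (f j ≤? f i)) j≤i))
  ; trans′  = λ i j l i≤j j≤l → from (⌊⌋≡true⇔ (f i ≤? f l))
      (ℕₚ.≤-trans (to (⌊⌋≡true⇔ (f i ≤? f j)) i≤j) (to (⌊⌋≡true⇔ (f j ≤? f l)) j≤l))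
  ; total   = λ i j →
      Sum.map (from (⌊⌋≡true⇔ (f i ≤? f j))) (from (⌊⌋≡true⇔ (f j ≤? f i)))
              (Finₚ.≤-total (f i) (f j))
  }

≤ᵇ-on-≐⇒<⇔ : {f : Fin n → Fin k} {g : Fin n → Fin p} →
             (_≤ᵇ_ on f) ≐ (_≤ᵇ_ on g) → ∀ i j → f i < f j ⇔ g i < g j
≤ᵇ-on-≐⇒<⇔ {f = f} {g} f≐g i j = mk⇔
  (λ fi<fj → ℕₚ.≰⇒> (λ gj≤gi → ℕₚ.<⇒≱ fi<fj (from gj≤gi⇔fj≤fi gj≤gi)))
  (λ gi<gj → ℕₚ.≰⇒> (λ fj≤fi → ℕₚ.<⇒≱ gi<gj (to gj≤gi⇔fj≤fi fj≤fi)))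
  where
  gj≤gi⇔fj≤fi : f j ≤ f i ⇔ g j ≤ g i
  gj≤gi⇔fj≤fi = to (⌊⌋≡⌊⌋⇔ (f j ≤? f i) (g j ≤? g i)) (f≐g j i)

≤ᵇ-on-⟨$⟩ʳ-injective : (π π′ : Permutation′ n) →
                       (_≤ᵇ_ on (π ⟨$⟩ʳ_)) ≐ (_≤ᵇ_ on (π′ ⟨$⟩ʳ_)) → ∀ i → π ⟨$⟩ʳ i ≡ π′ ⟨$⟩ʳ i
≤ᵇ-on-⟨$⟩ʳ-injective π π′ π≐π′ i = Finₚ.toℕ-injective (begin
  toℕ (π ⟨$⟩ʳ i)                           ≡⟨ toℕ-⟨$⟩ʳ≡count< π i ⟩
  count (λ j → π ⟨$⟩ʳ j <? π ⟨$⟩ʳ i)       ≡⟨ count-cong (λ j → ≤ᵇ-on-≐⇒<⇔ π≐π′ j i) ⟩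
  count (λ j → π′ ⟨$⟩ʳ j <? π′ ⟨$⟩ʳ i)     ≡⟨ toℕ-⟨$⟩ʳ≡count< π′ i ⟨
  toℕ (π′ ⟨$⟩ʳ i)                          ∎)
  where open ≡-Reasoning

ord-isTotalOrder : (σ : Perm n) → IsTotalOrder (ord σ)
ord-isTotalOrder σ = ≤ᵇ-on-isTotalOrder {f = σ ⟨$⟩ˡ_} (Injection.injective (↔⇒↣ (flip σ)))

ord-injective : (σ σ′ : Perm n) → ord σ ≐ ord σ′ → σ ≈ₚ σ′
ord-injective σ σ′ σ≐σ′ i = begin
  σ ⟨$⟩ʳ i                        ≡⟨ inverseʳ σ′ ⟨
  σ′ ⟨$⟩ʳ (σ′ ⟨$⟩ˡ (σ ⟨$⟩ʳ i))    ≡⟨ cong (σ′ ⟨$⟩ʳ_) (σ⁻¹≗σ′⁻¹ (σ ⟨$⟩ʳ i)) ⟨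
  σ′ ⟨$⟩ʳ (σ ⟨$⟩ˡ (σ ⟨$⟩ʳ i))     ≡⟨ cong (σ′ ⟨$⟩ʳ_) (inverseˡ σ) ⟩
  σ′ ⟨$⟩ʳ i                       ∎
  where
  open ≡-Reasoning
  σ⁻¹≗σ′⁻¹ : ∀ j → σ ⟨$⟩ˡ j ≡ σ′ ⟨$⟩ˡ j
  σ⁻¹≗σ′⁻¹ = ≤ᵇ-on-⟨$⟩ʳ-injective (flip σ) (flip σ′) σ≐σ′

-- Total orders are induced by permutations

injective⇒surjective : {f : Fin n → Fin n} → Injective _≡_ _≡_ f → ∀ j → ∃[ i ] f i ≡ j
injective⇒surjective {zero}          f-inj ()
injective⇒surjective {suc n} {f = f} f-inj j with Finₚ.any? (λ i → f i Finₚ.≟ j)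
... | yes hit = hit
... | no ¬hit = contradiction (Finₚ.injective⇒≤ f-without-j-injective) ℕₚ.1+n≰n
  where
  j≢f : ∀ i → j ≢ f i
  j≢f i j≡fi = ¬hit (i , sym j≡fi)

  -- If j is missed, punching it out of the values of f leaves an injection Fin (suc n) → Fin n.
  f-without-j-injective : Injective _≡_ _≡_ (λ i → Fin.punchOut (j≢f i))
  f-without-j-injective eq = f-inj (Finₚ.punchOut-injective (j≢f _) (j≢f _) eq)

injective⇒permutation : {f : Fin n → Fin n} → Injective _≡_ _≡_ f → Permutation′ n
injective⇒permutation {f = f} f-inj =
  permutation f (proj₁ ∘ surj) (proj₂ ∘ surj) (λ i → f-inj (proj₂ (surj (f i))))
  where
  surj = injective⇒surjective f-inj

module Rank {T : BRel n} (T-isTotalOrder : IsTotalOrder T) where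
  open IsTotalOrder T-isTotalOrder

  _≺_ : Fin n → Fin n → Set
  b ≺ a = T b a ≡ true × T a b ≢ true

  _≺?_ : ∀ b a → Dec (b ≺ a)
  b ≺? a = (T b a Boolₚ.≟ true) ×-dec ¬? (T a b Boolₚ.≟ true)

  rank : Fin n → ℕ
  rank a = count (_≺? a)

  rank-mono : ∀ {a b} → T a b ≡ true → rank a ℕ.≤ rank b
  rank-mono Tab =
    count-mono (λ (Tca , ¬Tac) → trans′ _ _ _ Tca Tab , λ Tbc → ¬Tac (trans′ _ _ _ Tab Tbc))

  rank-strict : ∀ {a b} → T a b ≢ true → rank b ℕ.< rank a
  rank-strict {a} {b} ¬Tab = count-mono-< ≺b⊆≺a b (λ (Tbb , ¬Tbb) → ¬Tbb Tbb) (Tba , ¬Tab)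
    where
    Tba : T b a ≡ true
    Tba = Sum.[ flip′ contradiction ¬Tab , id ] (total a b)

    ≺b⊆≺a : (_≺ b) ⊆ (_≺ a)
    ≺b⊆≺a (Tcb , ¬Tbc) = trans′ _ _ _ Tcb Tba , λ Tac → ¬Tab (trans′ _ _ _ Tac Tcb)

  rank< : ∀ a → rank a ℕ.< n
  rank< a = subst (rank a ℕ.<_) (count-all U? (λ _ → tt))
                  (count-mono-< (λ _ → tt) a (λ (Taa , ¬Taa) → ¬Taa Taa) tt)

  rank-≤⇔ : ∀ {a b} → rank a ℕ.≤ rank b ⇔ T a b ≡ true
  rank-≤⇔ {a} {b} = mk⇔ ≤⇒T rank-mono
    where
    ≤⇒T : rank a ℕ.≤ rank b → T a b ≡ true
    ≤⇒T ra≤rb with T a b Boolₚ.≟ true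
    ... | yes Tab = Tab
    ... | no ¬Tab = contradiction ra≤rb (ℕₚ.<⇒≱ (rank-strict ¬Tab))

  position : Fin n → Fin n
  position a = fromℕ< (rank< a)

  position-≤⇔ : ∀ {a b} → position a ≤ position b ⇔ T a b ≡ true
  position-≤⇔ {a} {b} rewrite Finₚ.toℕ-fromℕ< (rank< a) | Finₚ.toℕ-fromℕ< (rank< b) = rank-≤⇔

  position-injective : Injective _≡_ _≡_ position
  position-injective {a} {b} eq =
    antisym a b (to position-≤⇔ (Finₚ.≤-reflexive eq)) (to position-≤⇔ (Finₚ.≤-reflexive (sym eq)))

  σ : Perm n
  σ = flip (injective⇒permutation position-injective)

  ord-σ : ord σ ≐ T
  ord-σ a b = Boolₚ.⇔→≡ (⇔.trans (⌊⌋≡true⇔ (position a ≤? position b)) position-≤⇔)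

ord-surjective : (T : BRel n) → IsTotalOrder T → ∃[ σ ] ord σ ≐ T
ord-surjective T T-isTotalOrder = σ , ord-σ
  where open Rank T-isTotalOrder

-- Precedence in lists

data Precedes {A : Set a} : List A → A → A → Set a where
  here  : ∀ {x y xs} → y ∈ x ∷ xs → Precedes (x ∷ xs) x y
  there : ∀ {x y z xs} → Precedes xs x y → Precedes (z ∷ xs) x y

Precedes⇒∈ˡ : ∀ {xs : List A} {x y} → Precedes xs x y → x ∈ xs
Precedes⇒∈ˡ (here _)  = here refl
Precedes⇒∈ˡ (there p) = there (Precedes⇒∈ˡ p)

Precedes⇒∈ʳ : ∀ {xs : List A} {x y} → Precedes xs x y → y ∈ xs
Precedes⇒∈ʳ (here y∈)  = y∈
Precedes⇒∈ʳ (there p) = there (Precedes⇒∈ʳ p)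

Precedes-tail : ∀ {xs : List A} {x y z} → x ≢ z → Precedes (z ∷ xs) x y → Precedes xs x y
Precedes-tail x≢x (here _)  = contradiction refl x≢x
Precedes-tail _   (there p) = p

Precedes-≡ : ∀ {xs ys : List A} → Unique xs → Unique ys →
             (∀ x y → Precedes xs x y ⇔ Precedes ys x y) → xs ≡ ys
Precedes-≡ {xs = []}     {[]}     _ _ _ = refl
Precedes-≡ {xs = []}     {y ∷ ys} _ _ xs⇔ys with () ← from (xs⇔ys y y) (here (here refl))
Precedes-≡ {xs = x ∷ xs} {[]}     _ _ xs⇔ys with () ← to (xs⇔ys x x) (here (here refl))
Precedes-≡ {xs = x ∷ xs} {y ∷ ys} x∷xs!@(_ ∷ xs!) y∷ys!@(_ ∷ ys!) xs⇔ys
  with to (xs⇔ys x y) (here (Precedes⇒∈ˡ (from (xs⇔ys y y) (here (here refl)))))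
... | there x≤y = contradiction (Precedes⇒∈ʳ x≤y) (Uniqueₚ.Unique[x∷xs]⇒x∉xs y∷ys!)
... | here _    = cong (x ∷_) (Precedes-≡ xs! ys! tails⇔)
  where
  ≢x : ∀ {zs a b} → Unique (x ∷ zs) → Precedes zs a b → a ≢ x
  ≢x x∷zs! a≤b a≡x = Uniqueₚ.Unique[x∷xs]⇒x∉xs x∷zs! (subst (_∈ _) a≡x (Precedes⇒∈ˡ a≤b))

  tails⇔ : ∀ a b → Precedes xs a b ⇔ Precedes ys a b
  tails⇔ a b = mk⇔
    (λ a≤b → Precedes-tail (≢x x∷xs! a≤b) (to (xs⇔ys a b) (there a≤b)))
    (λ a≤b → Precedes-tail (≢x y∷ys! a≤b) (from (xs⇔ys a b) (there a≤b)))

module _ {g : A → Maybe B} where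

  mapMaybe-just : ∀ {x b} xs → g x ≡ just b → mapMaybe g (x ∷ xs) ≡ b ∷ mapMaybe g xs
  mapMaybe-just xs gx≡b rewrite gx≡b = refl

  ∈-mapMaybe⁺ : ∀ {xs x b} → x ∈ xs → g x ≡ just b → b ∈ mapMaybe g xs
  ∈-mapMaybe⁺ {y ∷ xs} (here refl) gx≡b = subst (_ ∈_) (sym (mapMaybe-just xs gx≡b)) (here refl)
  ∈-mapMaybe⁺ {y ∷ xs} (there x∈) gx≡b with g y
  ... | just _  = there (∈-mapMaybe⁺ x∈ gx≡b)
  ... | nothing = ∈-mapMaybe⁺ x∈ gx≡b

  ∈-mapMaybe⁻ : ∀ {xs b} → b ∈ mapMaybe g xs → ∃[ x ] x ∈ xs × g x ≡ just b
  ∈-mapMaybe⁻ {y ∷ xs} b∈ with g y in gy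
  ∈-mapMaybe⁻ {y ∷ xs} (here refl) | just _ = y , here refl , gy
  ∈-mapMaybe⁻ {y ∷ xs} (there b∈) | just _ = Product.map₂ (Product.map₁ there) (∈-mapMaybe⁻ b∈)
  ∈-mapMaybe⁻ {y ∷ xs} b∈          | nothing = Product.map₂ (Product.map₁ there) (∈-mapMaybe⁻ b∈)

  Precedes-mapMaybe⁺ : ∀ {xs x y a b} → Precedes xs x y → g x ≡ just a → g y ≡ just b →
                       Precedes (mapMaybe g xs) a b
  Precedes-mapMaybe⁺ {x ∷ xs} {b = b} (here y∈) gx≡a gy≡b =
    subst (λ zs → Precedes zs _ b) (sym (mapMaybe-just xs gx≡a))
          (here (subst (b ∈_) (mapMaybe-just xs gx≡a) (∈-mapMaybe⁺ y∈ gy≡b)))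
  Precedes-mapMaybe⁺ {z ∷ xs} (there x≤y) gx≡a gy≡b with g z
  ... | just _  = there (Precedes-mapMaybe⁺ x≤y gx≡a gy≡b)
  ... | nothing = Precedes-mapMaybe⁺ x≤y gx≡a gy≡b

  module _ (g-injective : ∀ {x y b} → g x ≡ just b → g y ≡ just b → x ≡ y) where

    Precedes-mapMaybe⁻ : ∀ {xs x y a b} → Precedes (mapMaybe g xs) a b →
                         g x ≡ just a → g y ≡ just b → Precedes xs x y
    Precedes-mapMaybe⁻ {z ∷ xs} a≤b gx≡a gy≡b with g z in gz
    ... | nothing = there (Precedes-mapMaybe⁻ a≤b gx≡a gy≡b)
    Precedes-mapMaybe⁻ {z ∷ xs} (there a≤b) gx≡a gy≡b | just _ =
      there (Precedes-mapMaybe⁻ a≤b gx≡a gy≡b)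
    Precedes-mapMaybe⁻ {z ∷ xs} (here b∈) gx≡a gy≡b | just _
      with refl ← g-injective gx≡a gz
      with y′ , y′∈ , gy′≡b ← ∈-mapMaybe⁻ {z ∷ xs} (subst (_ ∈_) (sym (mapMaybe-just xs gz)) b∈)
      with refl ← g-injective gy≡b gy′≡b = here y′∈

    Unique-mapMaybe : ∀ {xs} → Unique xs → Unique (mapMaybe g xs)
    Unique-mapMaybe {[]}     []           = []
    Unique-mapMaybe {y ∷ xs} (y∉xs ∷ xs!) with g y in gy
    ... | nothing = Unique-mapMaybe xs!
    ... | just _  = All.tabulate b≢ ∷ Unique-mapMaybe xs!
      where
      b≢ : ∀ {c} → c ∈ mapMaybe g xs → _ ≢ c
      b≢ c∈ refl with x , x∈ , gx ← ∈-mapMaybe⁻ c∈ = All.lookup y∉xs x∈ (g-injective gy gx)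

Precedes-tabulate⁺ : (f : Fin n → A) {i j : Fin n} → i ≤ j → Precedes (tabulate f) (f i) (f j)
Precedes-tabulate⁺ f {zero}  {j}     _         = here (∈-tabulate⁺ {f = f} j)
Precedes-tabulate⁺ f {suc i} {suc j} (ℕ.s≤s i≤j) = there (Precedes-tabulate⁺ (f ∘ suc) i≤j)

Precedes-tabulate⁻ : {f : Fin n → A} → Injective _≡_ _≡_ f → ∀ {a b} → Precedes (tabulate f) a b →
                     ∀ {i j} → f i ≡ a → f j ≡ b → i ≤ j
Precedes-tabulate⁻ f-inj _ {zero} _ _ = ℕ.z≤n
Precedes-tabulate⁻ f-inj (here _) {suc i} fi≡f0 _ with () ← f-inj fi≡f0
Precedes-tabulate⁻ f-inj (there a≤b) {suc i} {zero} _ f0≡b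
  with k , b≡fk ← ∈-tabulate⁻ (Precedes⇒∈ʳ a≤b)
  with () ← f-inj (trans f0≡b b≡fk)
Precedes-tabulate⁻ f-inj (there a≤b) {suc i} {suc j} fi≡a fj≡b =
  ℕ.s≤s (Precedes-tabulate⁻ (Finₚ.suc-injective ∘ f-inj) a≤b fi≡a fj≡b)

word≡tabulate : (σ : Perm n) → word σ ≡ tabulate (σ ⟨$⟩ʳ_)
word≡tabulate σ = LP.map-tabulate id (σ ⟨$⟩ʳ_)

Precedes-word⇔ : (σ : Perm n) {a b : Fin n} → Precedes (word σ) a b ⇔ σ ⟨$⟩ˡ a ≤ σ ⟨$⟩ˡ b
Precedes-word⇔ σ {a} {b} rewrite word≡tabulate σ = mk⇔
  (λ a≤b → Precedes-tabulate⁻ (Injection.injective (↔⇒↣ σ)) a≤b (inverseʳ σ) (inverseʳ σ))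
  (λ le → subst₂ (Precedes _) (inverseʳ σ) (inverseʳ σ) (Precedes-tabulate⁺ (σ ⟨$⟩ʳ_) le))

Unique-word : (σ : Perm n) → Unique (word σ)
Unique-word σ rewrite word≡tabulate σ = Uniqueₚ.tabulate⁺ (Injection.injective (↔⇒↣ σ))

module _ (ρ : Perm n) {g : Fin n → Maybe (Fin k)} {e : Fin k → Fin n}
         (g∘e : ∀ a → g (e a) ≡ just a) (g⇒e : ∀ {p a} → g p ≡ just a → p ≡ e a) where

  private
    g-injective : ∀ {p q a} → g p ≡ just a → g q ≡ just a → p ≡ q
    g-injective gp≡a gq≡a = trans (g⇒e gp≡a) (sym (g⇒e gq≡a))

  Precedes-subword⇔ : ∀ {a b} → Precedes (mapMaybe g (word ρ)) a b ⇔ ρ ⟨$⟩ˡ e a ≤ ρ ⟨$⟩ˡ e b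
  Precedes-subword⇔ {a} {b} = ⇔.trans
    (mk⇔ (λ a≤b → Precedes-mapMaybe⁻ g-injective a≤b (g∘e a) (g∘e b))
         (λ ea≤eb → Precedes-mapMaybe⁺ ea≤eb (g∘e a) (g∘e b)))
    (Precedes-word⇔ ρ)

  subword≡word⇔ : (σ : Perm k) →
                  mapMaybe g (word ρ) ≡ word σ ⇔ (∀ a b → ord ρ (e a) (e b) ≡ ord σ a b)
  subword≡word⇔ σ = mk⇔ ⇒ ⇐
    where
    ord≡⇔ : ∀ a b → ord ρ (e a) (e b) ≡ ord σ a b ⇔ (ρ ⟨$⟩ˡ e a ≤ ρ ⟨$⟩ˡ e b ⇔ σ ⟨$⟩ˡ a ≤ σ ⟨$⟩ˡ b)
    ord≡⇔ a b = ⌊⌋≡⌊⌋⇔ (ρ ⟨$⟩ˡ e a ≤? ρ ⟨$⟩ˡ e b) (σ ⟨$⟩ˡ a ≤? σ ⟨$⟩ˡ b)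

    ⇒ : mapMaybe g (word ρ) ≡ word σ → ∀ a b → ord ρ (e a) (e b) ≡ ord σ a b
    ⇒ eq a b = from (ord≡⇔ a b) (⇔.trans (⇔.sym Precedes-subword⇔)
      (subst (λ zs → Precedes zs a b ⇔ σ ⟨$⟩ˡ a ≤ σ ⟨$⟩ˡ b) (sym eq) (Precedes-word⇔ σ)))

    ⇐ : (∀ a b → ord ρ (e a) (e b) ≡ ord σ a b) → mapMaybe g (word ρ) ≡ word σ
    ⇐ ord≡ = Precedes-≡ (Unique-mapMaybe g-injective (Unique-word ρ)) (Unique-word σ) λ a b →
      ⇔.trans Precedes-subword⇔ (⇔.trans (to (ord≡⇔ a b) (ord≡ a b)) (⇔.sym (Precedes-word⇔ σ)))

-- Products

data Block (m n : ℕ) : Fin (m + n) → Set where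
  inˡ : (i : Fin m) → Block m n (i ↑ˡ n)
  inʳ : (j : Fin n) → Block m n (m ↑ʳ j)

block : ∀ m n (p : Fin (m + n)) → Block m n p
block m n p with splitAt m p in eq
... | inj₁ i = subst (Block m n) (Finₚ.splitAt⁻¹-↑ˡ eq) (inˡ i)
... | inj₂ j = subst (Block m n) (Finₚ.splitAt⁻¹-↑ʳ eq) (inʳ j)

restrictˡ : BRel (m + n) → BRel m
restrictˡ {n = n} T i j = T (i ↑ˡ n) (j ↑ˡ n)

restrictʳ : BRel (m + n) → BRel n
restrictʳ {m = m} T i j = T (m ↑ʳ i) (m ↑ʳ j)

module _ {m n : ℕ} where

  leftVal-↑ˡ : ∀ i → leftVal {m} {n} (i ↑ˡ n) ≡ just i
  leftVal-↑ˡ i rewrite Finₚ.splitAt-↑ˡ m i n = refl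

  leftVal⇒↑ˡ : ∀ {p i} → leftVal {m} {n} p ≡ just i → p ≡ i ↑ˡ n
  leftVal⇒↑ˡ {p} _ with splitAt m p in eq
  leftVal⇒↑ˡ refl | inj₁ i = sym (Finₚ.splitAt⁻¹-↑ˡ eq)

  rightVal-↑ʳ : ∀ j → rightVal {m} {n} (m ↑ʳ j) ≡ just j
  rightVal-↑ʳ j rewrite Finₚ.splitAt-↑ʳ m n j = refl

  rightVal⇒↑ʳ : ∀ {p j} → rightVal {m} {n} p ≡ just j → p ≡ m ↑ʳ j
  rightVal⇒↑ʳ {p} _ with splitAt m p in eq
  rightVal⇒↑ʳ refl | inj₂ j = sym (Finₚ.splitAt⁻¹-↑ʳ eq)

MRProd⇔restrict : (σ : Perm m) (τ : Perm n) (ρ : Perm (m + n)) →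
                  MRProd σ τ ρ ⇔ (restrictˡ (ord ρ) ≐ ord σ × restrictʳ (ord ρ) ≐ ord τ)
MRProd⇔restrict σ τ ρ =
  subword≡word⇔ ρ leftVal-↑ˡ leftVal⇒↑ˡ σ ×-⇔ subword≡word⇔ ρ rightVal-↑ʳ rightVal⇒↑ʳ τ

module _ {m n : ℕ} (R : BRel m) (S : BRel n)
         (I : Fin m → Fin n → Bool) (D : Fin n → Fin m → Bool) where

  shuffle : BRel (m + n)
  shuffle p q = embR {m} {n} R p q ∨ embS {m} {n} S p q ∨ embI {m} {n} I p q ∨ embD {m} {n} D p q

  shuffle-↑ˡ-↑ˡ : ∀ i j → shuffle (i ↑ˡ n) (j ↑ˡ n) ≡ R i j
  shuffle-↑ˡ-↑ˡ i j rewrite Finₚ.splitAt-↑ˡ m i n | Finₚ.splitAt-↑ˡ m j n = Boolₚ.∨-identityʳ _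

  shuffle-↑ˡ-↑ʳ : ∀ i j → shuffle (i ↑ˡ n) (m ↑ʳ j) ≡ I i j
  shuffle-↑ˡ-↑ʳ i j rewrite Finₚ.splitAt-↑ˡ m i n | Finₚ.splitAt-↑ʳ m n j = Boolₚ.∨-identityʳ _

  shuffle-↑ʳ-↑ˡ : ∀ j i → shuffle (m ↑ʳ j) (i ↑ˡ n) ≡ D j i
  shuffle-↑ʳ-↑ˡ j i rewrite Finₚ.splitAt-↑ʳ m n j | Finₚ.splitAt-↑ˡ m i n = refl

  shuffle-↑ʳ-↑ʳ : ∀ i j → shuffle (m ↑ʳ i) (m ↑ʳ j) ≡ S i j
  shuffle-↑ʳ-↑ʳ i j rewrite Finₚ.splitAt-↑ʳ m n i | Finₚ.splitAt-↑ʳ m n j = Boolₚ.∨-identityʳ _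

InSh⇔restrict : (T : BRel (m + n)) (R : BRel m) (S : BRel n) →
                InSh T R S ⇔ (restrictˡ T ≐ R × restrictʳ T ≐ S)
InSh⇔restrict {m} {n} T R S = mk⇔ ⇒ ⇐
  where
  ⇒ : InSh T R S → restrictˡ T ≐ R × restrictʳ T ≐ S
  ⇒ (I , D , T≡shuffle) =
      (λ i j → trans (T≡shuffle _ _) (shuffle-↑ˡ-↑ˡ R S I D i j))
    , (λ i j → trans (T≡shuffle _ _) (shuffle-↑ʳ-↑ʳ R S I D i j))

  I : Fin m → Fin n → Bool
  I i j = T (i ↑ˡ n) (m ↑ʳ j)

  D : Fin n → Fin m → Bool
  D j i = T (m ↑ʳ j) (i ↑ˡ n)

  ⇐ : restrictˡ T ≐ R × restrictʳ T ≐ S → InSh T R S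
  ⇐ (Tˡ≐R , Tʳ≐S) = I , D , T≡shuffle
    where
    T≡shuffle : ∀ p q → T p q ≡ shuffle R S I D p q
    T≡shuffle p q with block m n p | block m n q
    ... | inˡ i | inˡ j = trans (Tˡ≐R i j) (sym (shuffle-↑ˡ-↑ˡ R S I D i j))
    ... | inˡ i | inʳ j = sym (shuffle-↑ˡ-↑ʳ R S I D i j)
    ... | inʳ j | inˡ i = sym (shuffle-↑ʳ-↑ˡ R S I D j i)
    ... | inʳ i | inʳ j = trans (Tʳ≐S i j) (sym (shuffle-↑ʳ-↑ʳ R S I D i j))

MRProd⇔InSh : (σ : Perm m) (τ : Perm n) (ρ : Perm (m + n)) →
              MRProd σ τ ρ ⇔ (InSh (ord ρ) (ord σ) (ord τ) × IsTotalOrder (ord ρ))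
MRProd⇔InSh σ τ ρ = mk⇔
  (λ prod → from InSh⇔ (to MRProd⇔ prod) , ord-isTotalOrder ρ)
  (λ (sh , _) → from MRProd⇔ (to InSh⇔ sh))
  where
  MRProd⇔ = MRProd⇔restrict σ τ ρ
  InSh⇔   = InSh⇔restrict (ord ρ) (ord σ) (ord τ)

-- Coproducts

↑ˡ-≤⇔ : ∀ n {i j : Fin m} → i ↑ˡ n ≤ j ↑ˡ n ⇔ i ≤ j
↑ˡ-≤⇔ n {i} {j} rewrite Finₚ.toℕ-↑ˡ i n | Finₚ.toℕ-↑ˡ j n = ⇔.refl

↑ʳ-≤⇔ : ∀ m {i j : Fin n} → m ↑ʳ i ≤ m ↑ʳ j ⇔ i ≤ j
↑ʳ-≤⇔ m {i} {j} rewrite Finₚ.toℕ-↑ʳ m i | Finₚ.toℕ-↑ʳ m j =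
  mk⇔ (ℕₚ.+-cancelˡ-≤ m _ _) (ℕₚ.+-monoʳ-≤ m)

↑ˡ<↑ʳ : (i : Fin m) (j : Fin n) → i ↑ˡ n < m ↑ʳ j
↑ˡ<↑ʳ {m} {n} i j rewrite Finₚ.toℕ-↑ˡ i n | Finₚ.toℕ-↑ʳ m j =
  ℕₚ.<-≤-trans (Finₚ.toℕ<n i) (ℕₚ.m≤m+n m (toℕ j))

StrictlyIncreasing⇒<⇔ : {x : Fin k → Fin p} → StrictlyIncreasing x → ∀ i j → x i < x j ⇔ i < j
StrictlyIncreasing⇒<⇔ x↑ i j = mk⇔ reflect (x↑ i j)
  where
  reflect : _ → i < j
  reflect xi<xj with Finₚ.<-cmp i j
  ... | tri< i<j _ _ = i<j
  ... | tri≈ _ refl _ = contradiction xi<xj (ℕₚ.<-irrefl refl)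
  ... | tri> _ _ j<i = contradiction (x↑ j i j<i) (ℕₚ.<-asym xi<xj)

StrictlyIncreasing⇒injective : {x : Fin k → Fin p} → StrictlyIncreasing x → Injective _≡_ _≡_ x
StrictlyIncreasing⇒injective x↑ {i} {j} xi≡xj with Finₚ.<-cmp i j
... | tri< i<j _ _ = contradiction xi≡xj (Finₚ.<⇒≢ (x↑ i j i<j))
... | tri≈ _ i≡j _ = i≡j
... | tri> _ _ j<i = contradiction (sym xi≡xj) (Finₚ.<⇒≢ (x↑ j i j<i))

std≡count : (w : Fin k → Fin p) (i : Fin k) → std w i ≡ count (λ j → w j <? w i)
std≡count w i = length-filter-tabulate (λ j → w j <? w i) id

std-<⇒< : (w : Fin k → Fin p) {a b : Fin k} → std w a ℕ.< std w b → w a < w b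
std-<⇒< w {a} {b} sa<sb with w a <? w b
... | yes wa<wb = wa<wb
... | no wa≮wb  = contradiction sb≤sa (ℕₚ.<⇒≱ sa<sb)
  where
  sb≤sa : std w b ℕ.≤ std w a
  sb≤sa = subst₂ ℕ._≤_ (sym (std≡count w b)) (sym (std≡count w a))
            (count-mono (λ wc<wb → ℕₚ.<-≤-trans wc<wb (ℕₚ.≮⇒≥ wa≮wb)))

std≡⇔StrictlyIncreasing : (σ : Perm k) (w : Fin k → Fin p) →
                          (∀ i → toℕ (σ ⟨$⟩ʳ i) ≡ std w i) ⇔ StrictlyIncreasing (w ∘ (σ ⟨$⟩ˡ_))
std≡⇔StrictlyIncreasing σ w = mk⇔ ⇒ ⇐
  where
  ⇒ : (∀ i → toℕ (σ ⟨$⟩ʳ i) ≡ std w i) → StrictlyIncreasing (w ∘ (σ ⟨$⟩ˡ_))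
  ⇒ σ≡std i j i<j = std-<⇒< w (subst₂ ℕ._<_ (σ≡std (σ ⟨$⟩ˡ i)) (σ≡std (σ ⟨$⟩ˡ j))
    (subst₂ _<_ (sym (inverseʳ σ)) (sym (inverseʳ σ)) i<j))

  ⇐ : StrictlyIncreasing (w ∘ (σ ⟨$⟩ˡ_)) → ∀ i → toℕ (σ ⟨$⟩ʳ i) ≡ std w i
  ⇐ w∘σ⁻¹↑ i = begin
    toℕ (σ ⟨$⟩ʳ i)                      ≡⟨ toℕ-⟨$⟩ʳ≡count< σ i ⟩
    count (λ j → σ ⟨$⟩ʳ j <? σ ⟨$⟩ʳ i)  ≡⟨ count-cong (λ j → ⇔.sym (w<⇔σ< j)) ⟩
    count (λ j → w j <? w i)            ≡⟨ std≡count w i ⟨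
    std w i                             ∎
    where
    open ≡-Reasoning
    w<⇔σ< : ∀ j → w j < w i ⇔ σ ⟨$⟩ʳ j < σ ⟨$⟩ʳ i
    w<⇔σ< j = subst₂ (λ a b → w a < w b ⇔ σ ⟨$⟩ʳ j < σ ⟨$⟩ʳ i) (inverseˡ σ) (inverseˡ σ)
                (StrictlyIncreasing⇒<⇔ w∘σ⁻¹↑ (σ ⟨$⟩ʳ j) (σ ⟨$⟩ʳ i))

count-partition : {x : Fin m → Fin (m + n)} {y : Fin n → Fin (m + n)} →
                  Injective _≡_ _≡_ x → Injective _≡_ _≡_ y → (∀ i j → x i ≢ y j) →
                  {P : Pred (Fin (m + n)) ℓ} (P? : Decidable P) →
                  count P? ≡ count (P? ∘ x) + count (P? ∘ y)
count-partition {m} {n} {x = x} {y} x-inj y-inj x≢y P? = begin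
  count P?
    ≡⟨ count-permute P? (injective⇒permutation f-injective) ⟨
  count (P? ∘ f)
    ≡⟨ count-↑ˡ-↑ʳ m (P? ∘ f) ⟩
  count (P? ∘ f ∘ (_↑ˡ n)) + count (P? ∘ f ∘ (m ↑ʳ_))
    ≡⟨ cong₂ _+_ (count-∘-cong P? f-↑ˡ) (count-∘-cong P? f-↑ʳ) ⟩
  count (P? ∘ x) + count (P? ∘ y) ∎
  where
  open ≡-Reasoning
  f : Fin (m + n) → Fin (m + n)
  f = Sum.[ x , y ]′ ∘ splitAt m

  f-↑ˡ : ∀ i → f (i ↑ˡ n) ≡ x i
  f-↑ˡ i rewrite Finₚ.splitAt-↑ˡ m i n = refl

  f-↑ʳ : ∀ j → f (m ↑ʳ j) ≡ y j
  f-↑ʳ j rewrite Finₚ.splitAt-↑ʳ m n j = refl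

  f-injective : Injective _≡_ _≡_ f
  f-injective {p} {q} fp≡fq with block m n p | block m n q
  ... | inˡ i | inˡ j = cong (_↑ˡ n) (x-inj (trans (sym (f-↑ˡ i)) (trans fp≡fq (f-↑ˡ j))))
  ... | inˡ i | inʳ j = contradiction (trans (sym (f-↑ˡ i)) (trans fp≡fq (f-↑ʳ j))) (x≢y i j)
  ... | inʳ i | inˡ j = contradiction (trans (sym (f-↑ˡ j)) (trans (sym fp≡fq) (f-↑ʳ i))) (x≢y j i)
  ... | inʳ i | inʳ j = cong (m ↑ʳ_) (y-inj (trans (sym (f-↑ʳ i)) (trans fp≡fq (f-↑ʳ j))))

module Coproduct {m n : ℕ} (ρ : Perm (m + n)) (σ : Perm m) (τ : Perm n) where

  -- When the first m letters of ρ standardise to σ, x i is the i-th smallest of them.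
  x : Fin m → Fin (m + n)
  x i = ρ ⟨$⟩ʳ ((σ ⟨$⟩ˡ i) ↑ˡ n)

  y : Fin n → Fin (m + n)
  y j = ρ ⟨$⟩ʳ (m ↑ʳ (τ ⟨$⟩ˡ j))

  MRCoprod⇔increasing : MRCoprod ρ σ τ ⇔ (StrictlyIncreasing x × StrictlyIncreasing y)
  MRCoprod⇔increasing = std≡⇔StrictlyIncreasing σ _ ×-⇔ std≡⇔StrictlyIncreasing τ _

  ρ⁻¹x : ∀ i → ρ ⟨$⟩ˡ x i ≡ (σ ⟨$⟩ˡ i) ↑ˡ n
  ρ⁻¹x i = inverseˡ ρ

  ρ⁻¹y : ∀ j → ρ ⟨$⟩ˡ y j ≡ m ↑ʳ (τ ⟨$⟩ˡ j)
  ρ⁻¹y j = inverseˡ ρ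

  x-or-y : ∀ q → (∃[ i ] x i ≡ q) ⊎ (∃[ j ] y j ≡ q)
  x-or-y q with ρ ⟨$⟩ˡ q in ρ⁻¹q≡p
  ... | p with block m n p
  ...   | inˡ i = inj₁ (σ ⟨$⟩ʳ i , (begin
    ρ ⟨$⟩ʳ ((σ ⟨$⟩ˡ (σ ⟨$⟩ʳ i)) ↑ˡ n) ≡⟨ cong (λ k → ρ ⟨$⟩ʳ (k ↑ˡ n)) (inverseˡ σ) ⟩
    ρ ⟨$⟩ʳ (i ↑ˡ n)                   ≡⟨ cong (ρ ⟨$⟩ʳ_) ρ⁻¹q≡p ⟨
    ρ ⟨$⟩ʳ (ρ ⟨$⟩ˡ q)                 ≡⟨ inverseʳ ρ ⟩
    q                                 ∎))
    where open ≡-Reasoning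
  ...   | inʳ j = inj₂ (τ ⟨$⟩ʳ j , (begin
    ρ ⟨$⟩ʳ (m ↑ʳ (τ ⟨$⟩ˡ (τ ⟨$⟩ʳ j))) ≡⟨ cong (λ k → ρ ⟨$⟩ʳ (m ↑ʳ k)) (inverseˡ τ) ⟩
    ρ ⟨$⟩ʳ (m ↑ʳ j)                   ≡⟨ cong (ρ ⟨$⟩ʳ_) ρ⁻¹q≡p ⟨
    ρ ⟨$⟩ʳ (ρ ⟨$⟩ˡ q)                 ≡⟨ inverseʳ ρ ⟩
    q                                 ∎))
    where open ≡-Reasoning

  increasing⇒InStar : StrictlyIncreasing x × StrictlyIncreasing y → InStar (ord ρ) (ord σ) (ord τ)
  increasing⇒InStar (x↑ , y↑) = x , y , x↑ , y↑ , x≢y , x-or-y , cut , ord-x , ord-y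
    where
    x≢y : ∀ i j → x i ≢ y j
    x≢y i j xi≡yj = Finₚ.<⇒≢ (↑ˡ<↑ʳ (σ ⟨$⟩ˡ i) (τ ⟨$⟩ˡ j))
      (trans (sym (ρ⁻¹x i)) (trans (cong (ρ ⟨$⟩ˡ_) xi≡yj) (ρ⁻¹y j)))

    cut : ∀ i j → ord ρ (x i) (y j) ≡ true × ord ρ (y j) (x i) ≡ false
    cut i j rewrite ρ⁻¹x i | ρ⁻¹y j =
        from (⌊⌋≡true⇔ (_ ≤? _)) (ℕₚ.<⇒≤ (↑ˡ<↑ʳ (σ ⟨$⟩ˡ i) (τ ⟨$⟩ˡ j)))
      , from (⌊⌋≡false⇔ (_ ≤? _)) (ℕₚ.<⇒≱ (↑ˡ<↑ʳ (σ ⟨$⟩ˡ i) (τ ⟨$⟩ˡ j)))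

    ord-x : ∀ i i′ → ord ρ (x i) (x i′) ≡ ord σ i i′
    ord-x i i′ rewrite ρ⁻¹x i | ρ⁻¹x i′ = from (⌊⌋≡⌊⌋⇔ (_ ≤? _) (_ ≤? _)) (↑ˡ-≤⇔ n)

    ord-y : ∀ j j′ → ord ρ (y j) (y j′) ≡ ord τ j j′
    ord-y j j′ rewrite ρ⁻¹y j | ρ⁻¹y j′ = from (⌊⌋≡⌊⌋⇔ (_ ≤? _) (_ ≤? _)) (↑ʳ-≤⇔ m)

  -- In a total cut (x′, y′) of ord ρ, the position of each element in ρ is the number of elements
  -- before it, which the cut determines; hence x′ = x and y′ = y.
  module Cut {x′ : Fin m → Fin (m + n)} {y′ : Fin n → Fin (m + n)}
             (x′↑ : StrictlyIncreasing x′) (y′↑ : StrictlyIncreasing y′)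
             (x′≢y′ : ∀ i j → x′ i ≢ y′ j)
             (x′<y′ : ∀ i j → ρ ⟨$⟩ˡ x′ i < ρ ⟨$⟩ˡ y′ j) where

    toℕ-ρ⁻¹≡counts : ∀ q → toℕ (ρ ⟨$⟩ˡ q) ≡
                     count (λ i → ρ ⟨$⟩ˡ x′ i <? ρ ⟨$⟩ˡ q) + count (λ j → ρ ⟨$⟩ˡ y′ j <? ρ ⟨$⟩ˡ q)
    toℕ-ρ⁻¹≡counts q = trans (toℕ-⟨$⟩ʳ≡count< (flip ρ) q)
      (count-partition (StrictlyIncreasing⇒injective x′↑) (StrictlyIncreasing⇒injective y′↑)
                       x′≢y′ _)

    x′≗x : (∀ i i′ → ord ρ (x′ i) (x′ i′) ≡ ord σ i i′) → ∀ i → x′ i ≡ x i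
    x′≗x ord-x′ i = trans (sym (inverseʳ ρ)) (cong (ρ ⟨$⟩ʳ_) (Finₚ.toℕ-injective (begin
      toℕ (ρ ⟨$⟩ˡ x′ i)
        ≡⟨ toℕ-ρ⁻¹≡counts (x′ i) ⟩
      count (λ i′ → ρ ⟨$⟩ˡ x′ i′ <? ρ ⟨$⟩ˡ x′ i) + count (λ j → ρ ⟨$⟩ˡ y′ j <? ρ ⟨$⟩ˡ x′ i)
        ≡⟨ cong₂ _+_ (count-cong (λ i′ → ≤ᵇ-on-≐⇒<⇔ ord-x′ i′ i))
                     (count-none _ (λ j y′<x′ → ℕₚ.<-asym y′<x′ (x′<y′ i j))) ⟩
      count (λ i′ → σ ⟨$⟩ˡ i′ <? σ ⟨$⟩ˡ i) + 0
        ≡⟨ ℕₚ.+-identityʳ _ ⟩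
      count (λ i′ → σ ⟨$⟩ˡ i′ <? σ ⟨$⟩ˡ i)
        ≡⟨ toℕ-⟨$⟩ʳ≡count< (flip σ) i ⟨
      toℕ (σ ⟨$⟩ˡ i)
        ≡⟨ Finₚ.toℕ-↑ˡ (σ ⟨$⟩ˡ i) n ⟨
      toℕ ((σ ⟨$⟩ˡ i) ↑ˡ n) ∎)))
      where open ≡-Reasoning

    y′≗y : (∀ j j′ → ord ρ (y′ j) (y′ j′) ≡ ord τ j j′) → ∀ j → y′ j ≡ y j
    y′≗y ord-y′ j = trans (sym (inverseʳ ρ)) (cong (ρ ⟨$⟩ʳ_) (Finₚ.toℕ-injective (begin
      toℕ (ρ ⟨$⟩ˡ y′ j)
        ≡⟨ toℕ-ρ⁻¹≡counts (y′ j) ⟩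
      count (λ i → ρ ⟨$⟩ˡ x′ i <? ρ ⟨$⟩ˡ y′ j) + count (λ j′ → ρ ⟨$⟩ˡ y′ j′ <? ρ ⟨$⟩ˡ y′ j)
        ≡⟨ cong₂ _+_ (count-all _ (λ i → x′<y′ i j))
                     (count-cong (λ j′ → ≤ᵇ-on-≐⇒<⇔ ord-y′ j′ j)) ⟩
      m + count (λ j′ → τ ⟨$⟩ˡ j′ <? τ ⟨$⟩ˡ j)
        ≡⟨ cong (m +_) (toℕ-⟨$⟩ʳ≡count< (flip τ) j) ⟨
      m + toℕ (τ ⟨$⟩ˡ j)
        ≡⟨ Finₚ.toℕ-↑ʳ m (τ ⟨$⟩ˡ j) ⟨
      toℕ (m ↑ʳ (τ ⟨$⟩ˡ j)) ∎)))
      where open ≡-Reasoning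

  InStar⇒increasing : InStar (ord ρ) (ord σ) (ord τ) → StrictlyIncreasing x × StrictlyIncreasing y
  InStar⇒increasing (x′ , y′ , x′↑ , y′↑ , x′≢y′ , _ , cut , ord-x′ , ord-y′) =
      (λ i i′ i<i′ → subst₂ _<_ (x′≗x ord-x′ i) (x′≗x ord-x′ i′) (x′↑ i i′ i<i′))
    , (λ j j′ j<j′ → subst₂ _<_ (y′≗y ord-y′ j) (y′≗y ord-y′ j′) (y′↑ j j′ j<j′))
    where
    open Cut x′↑ y′↑ x′≢y′ (λ i j → ℕₚ.≰⇒> (to (⌊⌋≡false⇔ (_ ≤? _)) (proj₂ (cut i j))))

MRCoprod⇔InStar : (ρ : Perm (m + n)) (σ : Perm m) (τ : Perm n) →
                  MRCoprod ρ σ τ ⇔ InStar (ord ρ) (ord σ) (ord τ)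
MRCoprod⇔InStar ρ σ τ = ⇔.trans MRCoprod⇔increasing (mk⇔ increasing⇒InStar InStar⇒increasing)
  where open Coproduct ρ σ τ

mainTheorem13 :
  -- F_σ ↦ F_{≺σ} is well defined and a bijection onto the basis of WOEP^quo
  (∀ {n} (σ : Perm n) → IsTotalOrder (ord σ))
  × (∀ {n} (σ σ′ : Perm n) → ord σ ≐ ord σ′ → σ ≈ₚ σ′)
  × (∀ {n} (T : BRel n) → IsTotalOrder T → ∃[ σ ] ord σ ≐ T)
  -- compatibility with the products (coefficient of F_ρ ↦ F_{≺ρ})
  × (∀ {m n} (σ : Perm m) (τ : Perm n) (ρ : Perm (m + n)) →
       MRProd σ τ ρ ⇔ (InSh (ord ρ) (ord σ) (ord τ) × IsTotalOrder (ord ρ)))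
  -- compatibility with the coproducts (coefficient of F_σ ⊗ F_τ)
  × (∀ {m n} (ρ : Perm (m + n)) (σ : Perm m) (τ : Perm n) →
       MRCoprod ρ σ τ ⇔ InStar (ord ρ) (ord σ) (ord τ))
mainTheorem13 = ord-isTotalOrder , ord-injective , ord-surjective , MRProd⇔InSh , MRCoprod⇔InStar
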